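{- The two partial differential equations $D_LF=D_RF$ and $\tilde D_LF=\tilde D_RF$ have at most one common solution $F\in\mathbf{R}$ satisfying $F\equiv 1+tx\pmod{x^2}$.
   Context: $\mathbf{R}=\left(\mathbb{Q}[t,t^{ -1}]\right)[[x]]$ is the algebra of formal power series in $x$ with Laurent-polynomial coefficients in $t$. Let $\theta_t=t\frac{\partial}{\partial t}$ and $\theta_x=x\frac{\partial}{\partial x}$ act on $\mathbf{R}$. Define the operators (products are compositions, and the prefactors act by multiplication after applying the differential parts): $D_L=4tx\,(1+\theta_t+\theta_x)(2-3\theta_t+\theta_x)$, $D_R=(3\theta_t+\theta_x)(-2+3\theta_t+\theta_x)$, $\tilde D_L=4x\,(1-\theta_t+\theta_x)(3\theta_t+\theta_x)$, $\tilde D_R=t\,(2-3\theta_t+\theta_x)(-3\theta_t+\theta_x)$. -}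

module Defs where

open import Data.Nat as ℕ using (ℕ; zero; suc)
open import Data.Integer as ℤ using (ℤ; +_; -[1+_]; ∣_∣)
open import Data.Rational as ℚ using (ℚ; 0ℚ; 1ℚ; _/_)
open import Data.Product using (∃)
open import Relation.Nullary using (yes; no)
open import Relation.Binary.PropositionalEquality using (_≡_)

-- An element of R = (ℚ[t,t⁻¹])[[x]] is given by its coefficient array:
-- coeff n k = coefficient of x^n t^k, with finite support in k for each n.
Coeffs : Set
Coeffs = ℕ → ℤ → ℚ

IsInR : Coeffs → Set
IsInR F = ∀ (n : ℕ) → ∃ λ (B : ℕ) → ∀ (k : ℤ) → B ℕ.< ∣ k ∣ → F n k ≡ 0ℚ

ℤ→ℚ : ℤ → ℚ
ℤ→ℚ z = z / 1

-- the first order operator  a + b θ_t + c θ_x  (θ_t t^k x^n = k t^k x^n, θ_x t^k x^n = n t^k x^n)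
lin : ℤ → ℤ → ℤ → Coeffs → Coeffs
lin a b c F n k = ℤ→ℚ (a ℤ.+ b ℤ.* k ℤ.+ c ℤ.* (+ n)) ℚ.* F n k

mulT : Coeffs → Coeffs
mulT F n k = F n (k ℤ.- + 1)

mulX : Coeffs → Coeffs
mulX F zero    k = 0ℚ
mulX F (suc n) k = F n k

scale : ℚ → Coeffs → Coeffs
scale q F n k = q ℚ.* F n k

D-L : Coeffs → Coeffs
D-L F = scale (ℤ→ℚ (+ 4)) (mulT (mulX (lin (+ 1) (+ 1) (+ 1) (lin (+ 2) (ℤ.- + 3) (+ 1) F))))

D-R : Coeffs → Coeffs
D-R F = lin (+ 0) (+ 3) (+ 1) (lin (ℤ.- + 2) (+ 3) (+ 1) F)

D̃-L : Coeffs → Coeffs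
D̃-L F = scale (ℤ→ℚ (+ 4)) (mulX (lin (+ 1) (ℤ.- + 1) (+ 1) (lin (+ 0) (+ 3) (+ 1) F)))

D̃-R : Coeffs → Coeffs
D̃-R F = mulT (lin (+ 2) (ℤ.- + 3) (+ 1) (lin (+ 0) (ℤ.- + 3) (+ 1) F))

δ : ℤ → ℤ → ℚ
δ j k with j ℤ.≟ k
... | yes _ = 1ℚ
... | no _  = 0ℚ

InitCond : Coeffs → Set
InitCond F = (∀ k → F 0 k ≡ δ (+ 0) k) Data.Product.× (∀ k → F 1 k ≡ δ (+ 1) k)

IsCommonSolution : Coeffs → Set
IsCommonSolution F =
  (∀ n k → D-L F n k ≡ D-R F n k) Data.Product.× (∀ n k → D̃-L F n k ≡ D̃-R F n k)

module Submission where

-- The left operators D_L and D̃_L carry a factor x, so the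
-- coefficient of xⁿ in D_L F and D̃_L F involves only F (n-1).  The right operators contain
-- no x and act diagonally:  on xⁿ tᵏ, D_R multiplies by ρ₁ ρ₂ with ρ₁ = 3k+n, ρ₂ = 3k+n-2,
-- and D̃_R maps xⁿ tᵏ to σ₁ σ₂ xⁿ tᵏ⁺¹ with σ₁ = 2-3k+n, σ₂ = n-3k.  Hence both equations are
-- recursions expressing ρ₁ρ₂ F n k and σ₁σ₂ F n k through F (n-1).  For n ≥ 2 the pairwise
-- sums ρᵢ + σⱼ are 2n+2, 2n, 2n, 2n-2, all nonzero, so ρ₁ρ₂ and σ₁σ₂ cannot both vanish:
-- one of the two recursions always determines F n k.  Induction on n from the two
-- prescribed coefficients F 0 = 1 and F 1 = t then shows two common solutions coincide.

open import Defs
open import Relation.Binary.PropositionalEquality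
  using (_≡_; _≢_; refl; sym; trans; cong; module ≡-Reasoning)
open import Data.Nat as ℕ using (ℕ; zero; suc)
open import Data.Integer as ℤ using (ℤ; +_)
open import Data.Integer.Tactic.RingSolver using (solve-∀)
open import Data.Rational as ℚ using (ℚ; 0ℚ)
import Data.Rational.Properties as ℚP
open import Data.Integer.GCD using (gcd)
open import Data.Product using (_×_; _,_)
open import Data.Sum using (_⊎_; inj₁; inj₂)
open import Data.Empty using (⊥-elim)
open import Relation.Nullary using (yes; no)

factor : ℤ → ℤ → ℤ → ℕ → ℤ → ℤ
factor a b c n k = a ℤ.+ b ℤ.* k ℤ.+ c ℤ.* (+ n)

ℤ→ℚ-nonzero : ∀ z → z ≢ + 0 → ℤ→ℚ z ≢ 0ℚ
ℤ→ℚ-nonzero z z≢0 z/1≡0 = z≢0 (begin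
  z                          ≡⟨ sym (ℚP.↥-/ z 1) ⟩
  ℚ.↥ (ℤ→ℚ z) ℤ.* gcd z (+ 1) ≡⟨ cong (ℤ._* gcd z (+ 1)) (ℚP.p≡0⇒↥p≡0 _ z/1≡0) ⟩
  + 0                        ∎)
  where open ≡-Reasoning

*-cancelˡ-nonzero : ∀ q {p p′} → q ≢ 0ℚ → q ℚ.* p ≡ q ℚ.* p′ → p ≡ p′
*-cancelˡ-nonzero q {p} {p′} q≢0 qp≡qp′ = begin
  p                        ≡⟨ sym (undo p) ⟩
  ℚ.1/ q ℚ.* (q ℚ.* p)      ≡⟨ cong (ℚ.1/ q ℚ.*_) qp≡qp′ ⟩
  ℚ.1/ q ℚ.* (q ℚ.* p′)     ≡⟨ undo p′ ⟩
  p′                       ∎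
  where
  open ≡-Reasoning
  instance _ = ℚ.≢-nonZero q≢0
  undo : ∀ r → ℚ.1/ q ℚ.* (q ℚ.* r) ≡ r
  undo r = trans (sym (ℚP.*-assoc (ℚ.1/ q) q r))
                 (trans (cong (ℚ._* r) (ℚP.*-inverseˡ q)) (ℚP.*-identityˡ r))

cancel-factors : ∀ a b {p p′} → a ≢ + 0 → b ≢ + 0 →
  ℤ→ℚ a ℚ.* (ℤ→ℚ b ℚ.* p) ≡ ℤ→ℚ a ℚ.* (ℤ→ℚ b ℚ.* p′) → p ≡ p′
cancel-factors a b a≢0 b≢0 eq =
  *-cancelˡ-nonzero _ (ℤ→ℚ-nonzero b b≢0) (*-cancelˡ-nonzero _ (ℤ→ℚ-nonzero a a≢0) eq)

either-pair-nonzero : ∀ a b c d →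
  a ℤ.+ c ≢ + 0 → a ℤ.+ d ≢ + 0 → b ℤ.+ c ≢ + 0 → b ℤ.+ d ≢ + 0 →
  (a ≢ + 0 × b ≢ + 0) ⊎ (c ≢ + 0 × d ≢ + 0)
either-pair-nonzero a b c d a+c≢0 a+d≢0 b+c≢0 b+d≢0
  with a ℤ.≟ + 0 | b ℤ.≟ + 0 | c ℤ.≟ + 0 | d ℤ.≟ + 0
... | no a≢0   | no b≢0   | _        | _        = inj₁ (a≢0 , b≢0)
... | _        | _        | no c≢0   | no d≢0   = inj₂ (c≢0 , d≢0)
... | yes refl | _        | yes refl | _        = ⊥-elim (a+c≢0 refl)
... | yes refl | _        | _        | yes refl = ⊥-elim (a+d≢0 refl)
... | _        | yes refl | yes refl | _        = ⊥-elim (b+c≢0 refl)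
... | _        | yes refl | _        | yes refl = ⊥-elim (b+d≢0 refl)

ρ₁ ρ₂ σ₁ σ₂ : ℕ → ℤ → ℤ
ρ₁ = factor (+ 0) (+ 3) (+ 1)
ρ₂ = factor (ℤ.- + 2) (+ 3) (+ 1)
σ₁ = factor (+ 2) (ℤ.- + 3) (+ 1)
σ₂ = factor (+ 0) (ℤ.- + 3) (+ 1)

positive-offset-nonzero : ∀ {z} c m → z ≡ + suc c ℤ.+ (+ m ℤ.+ + m) → z ≢ + 0
positive-offset-nonzero c m refl ()

indicial-nonvanishing : ∀ m k → let n = suc (suc m) in
  (ρ₁ n k ≢ + 0 × ρ₂ n k ≢ + 0) ⊎ (σ₁ n k ≢ + 0 × σ₂ n k ≢ + 0)
indicial-nonvanishing m k = either-pair-nonzero _ _ _ _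
  (positive-offset-nonzero 5 m (ρ₁+σ₁ k (+ m))) (positive-offset-nonzero 3 m (ρ₁+σ₂ k (+ m)))
  (positive-offset-nonzero 3 m (ρ₂+σ₁ k (+ m))) (positive-offset-nonzero 1 m (ρ₂+σ₂ k (+ m)))
  where
  -- the x-degree is written  2 + M  so that the ring solver sees a polynomial identity
  ρ₁+σ₁ : ∀ k M → (+ 0 ℤ.+ + 3 ℤ.* k ℤ.+ + 1 ℤ.* (+ 2 ℤ.+ M))
                  ℤ.+ (+ 2 ℤ.+ (ℤ.- + 3) ℤ.* k ℤ.+ + 1 ℤ.* (+ 2 ℤ.+ M)) ≡ + 6 ℤ.+ (M ℤ.+ M)
  ρ₁+σ₁ = solve-∀
  ρ₁+σ₂ : ∀ k M → (+ 0 ℤ.+ + 3 ℤ.* k ℤ.+ + 1 ℤ.* (+ 2 ℤ.+ M))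
                  ℤ.+ (+ 0 ℤ.+ (ℤ.- + 3) ℤ.* k ℤ.+ + 1 ℤ.* (+ 2 ℤ.+ M)) ≡ + 4 ℤ.+ (M ℤ.+ M)
  ρ₁+σ₂ = solve-∀
  ρ₂+σ₁ : ∀ k M → ((ℤ.- + 2) ℤ.+ + 3 ℤ.* k ℤ.+ + 1 ℤ.* (+ 2 ℤ.+ M))
                  ℤ.+ (+ 2 ℤ.+ (ℤ.- + 3) ℤ.* k ℤ.+ + 1 ℤ.* (+ 2 ℤ.+ M)) ≡ + 4 ℤ.+ (M ℤ.+ M)
  ρ₂+σ₁ = solve-∀
  ρ₂+σ₂ : ∀ k M → ((ℤ.- + 2) ℤ.+ + 3 ℤ.* k ℤ.+ + 1 ℤ.* (+ 2 ℤ.+ M))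
                  ℤ.+ (+ 0 ℤ.+ (ℤ.- + 3) ℤ.* k ℤ.+ + 1 ℤ.* (+ 2 ℤ.+ M)) ≡ + 2 ℤ.+ (M ℤ.+ M)
  ρ₂+σ₂ = solve-∀

lin-cong : ∀ a b c (F G : Coeffs) n → (∀ k → F n k ≡ G n k) → ∀ k → lin a b c F n k ≡ lin a b c G n k
lin-cong a b c F G n F≡G k = cong (ℤ→ℚ (factor a b c n k) ℚ.*_) (F≡G k)

D-L-lowers-degree : ∀ F G m → (∀ k → F m k ≡ G m k) → ∀ k → D-L F (suc m) k ≡ D-L G (suc m) k
D-L-lowers-degree F G m F≡G k =
  cong (ℤ→ℚ (+ 4) ℚ.*_) (lin-cong (+ 1) (+ 1) (+ 1) (lin₂ F) (lin₂ G) m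
                                   (lin-cong (+ 2) (ℤ.- + 3) (+ 1) F G m F≡G) (k ℤ.- + 1))
  where
  lin₂ : Coeffs → Coeffs
  lin₂ = lin (+ 2) (ℤ.- + 3) (+ 1)

D̃-L-lowers-degree : ∀ F G m → (∀ k → F m k ≡ G m k) → ∀ k → D̃-L F (suc m) k ≡ D̃-L G (suc m) k
D̃-L-lowers-degree F G m F≡G k =
  cong (ℤ→ℚ (+ 4) ℚ.*_) (lin-cong (+ 1) (ℤ.- + 1) (+ 1) (lin₂ F) (lin₂ G) m
                                   (lin-cong (+ 0) (+ 3) (+ 1) F G m F≡G) k)
  where
  lin₂ : Coeffs → Coeffs
  lin₂ = lin (+ 0) (+ 3) (+ 1)

D̃-R-shift : ∀ F n k → D̃-R F n (k ℤ.+ + 1) ≡ ℤ→ℚ (σ₁ n k) ℚ.* (ℤ→ℚ (σ₂ n k) ℚ.* F n k)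
D̃-R-shift F n k = cong (lin (+ 2) (ℤ.- + 3) (+ 1) (lin (+ 0) (ℤ.- + 3) (+ 1) F) n) (k+1-1≡k k)
  where
  k+1-1≡k : ∀ k → (k ℤ.+ + 1) ℤ.- + 1 ≡ k
  k+1-1≡k = solve-∀

agreement-step : ∀ {F G} → IsCommonSolution F → IsCommonSolution G →
  ∀ m → (∀ k → F (suc m) k ≡ G (suc m) k) → ∀ k → F (suc (suc m)) k ≡ G (suc (suc m)) k
agreement-step {F} {G} (FL≡R , FL̃≡R̃) (GL≡R , GL̃≡R̃) m F≡G k
  with indicial-nonvanishing m k
... | inj₁ (ρ₁≢0 , ρ₂≢0) = cancel-factors _ _ ρ₁≢0 ρ₂≢0 (begin
  D-R F n k ≡⟨ sym (FL≡R n k) ⟩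
  D-L F n k ≡⟨ D-L-lowers-degree F G (suc m) F≡G k ⟩
  D-L G n k ≡⟨ GL≡R n k ⟩
  D-R G n k ∎)
  where
  open ≡-Reasoning
  n : ℕ
  n = suc (suc m)
... | inj₂ (σ₁≢0 , σ₂≢0) = cancel-factors _ _ σ₁≢0 σ₂≢0 (begin
  ℤ→ℚ (σ₁ n k) ℚ.* (ℤ→ℚ (σ₂ n k) ℚ.* F n k) ≡⟨ sym (D̃-R-shift F n k) ⟩
  D̃-R F n k+1                               ≡⟨ sym (FL̃≡R̃ n k+1) ⟩
  D̃-L F n k+1                               ≡⟨ D̃-L-lowers-degree F G (suc m) F≡G k+1 ⟩
  D̃-L G n k+1                               ≡⟨ GL̃≡R̃ n k+1 ⟩
  D̃-R G n k+1                               ≡⟨ D̃-R-shift G n k ⟩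
  ℤ→ℚ (σ₁ n k) ℚ.* (ℤ→ℚ (σ₂ n k) ℚ.* G n k) ∎)
  where
  open ≡-Reasoning
  n : ℕ
  n = suc (suc m)
  k+1 : ℤ
  k+1 = k ℤ.+ + 1

proposition5p1 : ∀ (F G : Coeffs) → IsInR F → IsInR G → InitCond F → InitCond G → IsCommonSolution F → IsCommonSolution G → ∀ n k → F n k ≡ G n k
proposition5p1 F G _ _ (F₀ , F₁) (G₀ , G₁) solF solG = agree
  where
  agree : ∀ n k → F n k ≡ G n k
  agree zero          k = trans (F₀ k) (sym (G₀ k))
  agree (suc zero)    k = trans (F₁ k) (sym (G₁ k))
  agree (suc (suc m))   = agreement-step solF solG m (agree (suc m))
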